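{- Let $p$ be a prime and let $i$ be an integer with $1 \leq i \leq p-2$ such that $i \equiv \frac{s}{r - s} \pmod{p}$ for some relatively prime positive integers $r, s < \sqrt{p}$ with $r \neq s$. Then \[\frac{p}{\max(r, s)} < x_i + y_i < \frac{p}{\max(r, s)} + \max(r, s) - 1.\]
   Context: Let $p$ be a prime. For $1 \leq i \leq p-2$, let $x_i^{\max}, y_i^{\max} \in \{1, \dots, p-1\}$ be the residues with $i\, x_i^{\max} \equiv 1 \pmod p$ and $-(i+1)\, y_i^{\max} \equiv 1 \pmod p$. Define $(x_i, y_i)$ to be the pair of positive integers $(x,y)$ with $x \leq x_i^{\max}$, $y \leq y_i^{\max}$ and $ix + (i+1)y \equiv 0 \pmod p$ for which $x + y$ is minimal (such a pair exists and is unique). Fractions modulo $p$ denote multiplication by modular inverses. -}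

module Defs where

open import Data.Nat as ℕ using (ℕ; _≤_; _<_; _⊔_; _∸_)
open import Data.Integer as ℤ using (ℤ; +_)
open import Data.Integer.Divisibility using () renaming (_∣_ to _∣ℤ_)
open import Data.Product using (_×_)

_≡_[mod_] : ℤ → ℤ → ℕ → Set
a ≡ b [mod p ] = (+ p) ∣ℤ (a ℤ.- b)

IsXMax : ℕ → ℕ → ℕ → Set
IsXMax p i xm = 1 ≤ xm × xm ≤ p ∸ 1 × ((+ i) ℤ.* (+ xm)) ≡ ℤ.1ℤ [mod p ]

IsYMax : ℕ → ℕ → ℕ → Set
IsYMax p i ym = 1 ≤ ym × ym ≤ p ∸ 1 × (ℤ.- ((+ i) ℤ.+ ℤ.1ℤ) ℤ.* (+ ym)) ≡ ℤ.1ℤ [mod p ]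

Admissible : ℕ → ℕ → ℕ → ℕ → ℕ → ℕ → Set
Admissible p i xm ym x y =
  1 ≤ x × 1 ≤ y × x ≤ xm × y ≤ ym ×
  ((+ i) ℤ.* (+ x) ℤ.+ ((+ i) ℤ.+ ℤ.1ℤ) ℤ.* (+ y)) ≡ ℤ.0ℤ [mod p ]

-- (x , y) = (x_i , y_i): the admissible pair with x + y minimal.
IsMinPair : ℕ → ℕ → ℕ → ℕ → Set
IsMinPair p i x y =
  ∀ {xm ym} → IsXMax p i xm → IsYMax p i ym →
    Admissible p i xm ym x y ×
    (∀ x′ y′ → Admissible p i xm ym x′ y′ → x ℕ.+ y ≤ x′ ℕ.+ y′)

-- Let M = max(r, s) and m = min(r, s). Multiplying by the unit r − s turns the admissibility
-- congruence i x + (i + 1) y ≡ 0 into s x + r y ≡ 0 (mod p), because i (r − s) ≡ s. So for an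
-- admissible pair, s x + r y is a positive multiple of p, whence p ≤ s x + r y ≤ M (x + y); the
-- inequality is strict since 1 < M < p and p is prime. For the upper bound, choose 1 ≤ u < M with
-- m u ≡ p (mod M) and write p = m u + M q. The congruences s x_i^max ≡ r − s and
-- r y_i^max ≡ s − r (mod p) show, by comparing sizes below p, that u and q do not exceed the
-- corresponding maxima, so (u, q) in the right order is admissible, and M (u + q) < p + M (M − 1).
-- Minimality of x_i + y_i finishes the proof.
module Submission where

open import Defs
open import Data.Nat using (ℕ; _≤_; _<_; _+_; _*_; _∸_; _⊔_)
open import Relation.Binary.PropositionalEquality using (_≢_)
open import Data.Nat.Primality using (Prime)
open import Data.Nat.Coprimality using (Coprime)
open import Data.Product using (_×_)
open import Data.Integer using (+_; _-_) renaming (_*_ to _*ℤ_)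

import Data.Nat as ℕ
open import Data.Nat
  using (NonZero; >-nonZero; z≤n; z<s; s≤s; s≤s⁻¹; n>1⇒nonTrivial; nonTrivial⇒n>1)
open import Data.Nat.Properties
open import Data.Nat.Divisibility
  using (_∣_; _∤_; divides; quotient; ∣-refl; ∣⇒≤; m∣n⇒n≡quotient*m)
open import Data.Nat.Primality using (composite; euclidsLemma; prime⇒nonTrivial; prime⇒nonZero)
open import Data.Nat.GCD using (module Bézout)
import Data.Nat.Coprimality as Coprimality
open import Data.Integer using (ℤ; -_; 0ℤ; 1ℤ; _%ℕ_; _/ℕ_) renaming (_+_ to _+ℤ_)
import Data.Integer as ℤ
import Data.Integer.Properties as ℤ
import Data.Integer.Divisibility.Signed as Signed
open import Data.Integer.DivMod using (n%ℕd<d; a≡a%ℕn+[a/ℕn]*n)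
open import Data.Integer.Tactic.RingSolver using (solve-∀)
open import Data.Product using (∃-syntax; _,_)
open import Data.Sum using (inj₁; inj₂)
open import Level using (0ℓ)
open import Relation.Binary using (Setoid; tri<; tri≈; tri>)
open import Relation.Binary.PropositionalEquality
  using (_≡_; refl; sym; trans; cong; cong₂; subst; subst₂; module ≡-Reasoning)
open import Relation.Nullary using (¬_; contradiction)
import Relation.Binary.Reasoning.Setoid as SetoidReasoning

-- Congruence modulo n as a record: the relation of Defs unfolds to a divisibility of absolute
-- values in ℕ, from which Agda cannot infer the two sides of the congruence.
record _≈_[mod_] (a b : ℤ) (n : ℕ) : Set where
  constructor ≈-mod
  field n∣a-b : + n Signed.∣ (a - b)

module _ {n : ℕ} where

  ≈⇒≡-mod : ∀ {a b} → a ≈ b [mod n ] → a ≡ b [mod n ]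
  ≈⇒≡-mod {a} {b} (≈-mod n∣a-b) = Signed.∣⇒∣ᵤ {i = a - b} n∣a-b

  ≡-mod⇒≈ : ∀ {a b} → a ≡ b [mod n ] → a ≈ b [mod n ]
  ≡-mod⇒≈ {a} {b} a≡b = ≈-mod (Signed.∣ᵤ⇒∣ {i = a - b} a≡b)

  private
    by : ∀ {d a b} → + n Signed.∣ d → d ≡ a - b → a ≈ b [mod n ]
    by n∣d d≡a-b = ≈-mod (subst (+ n Signed.∣_) d≡a-b n∣d)

  ≈-reflexive : ∀ {a b} → a ≡ b → a ≈ b [mod n ]
  ≈-reflexive {a} refl = by (Signed.divides 0ℤ refl) (sym (ℤ.+-inverseʳ a))

  ≈-refl : ∀ {a} → a ≈ a [mod n ]
  ≈-refl = ≈-reflexive refl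

  ≈-sym : ∀ {a b} → a ≈ b [mod n ] → b ≈ a [mod n ]
  ≈-sym {a} {b} (≈-mod n∣a-b) = by (Signed.∣m⇒∣-m n∣a-b) (swap a b)
    where
    swap : ∀ a b → - (a - b) ≡ b - a
    swap = solve-∀

  ≈-trans : ∀ {a b c} → a ≈ b [mod n ] → b ≈ c [mod n ] → a ≈ c [mod n ]
  ≈-trans {a} {b} {c} (≈-mod n∣a-b) (≈-mod n∣b-c) =
    by (Signed.∣m∣n⇒∣m+n n∣a-b n∣b-c) (telescope a b c)
    where
    telescope : ∀ a b c → (a - b) +ℤ (b - c) ≡ a - c
    telescope = solve-∀

  +-cong-mod : ∀ {a b c d} → a ≈ b [mod n ] → c ≈ d [mod n ] → (a +ℤ c) ≈ (b +ℤ d) [mod n ]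
  +-cong-mod {a} {b} {c} {d} (≈-mod n∣a-b) (≈-mod n∣c-d) =
    by (Signed.∣m∣n⇒∣m+n n∣a-b n∣c-d) (interchange a b c d)
    where
    interchange : ∀ a b c d → (a - b) +ℤ (c - d) ≡ (a +ℤ c) - (b +ℤ d)
    interchange = solve-∀

  +-congˡ-mod : ∀ c {a b} → a ≈ b [mod n ] → (c +ℤ a) ≈ (c +ℤ b) [mod n ]
  +-congˡ-mod c = +-cong-mod (≈-refl {c})

  +-congʳ-mod : ∀ c {a b} → a ≈ b [mod n ] → (a +ℤ c) ≈ (b +ℤ c) [mod n ]
  +-congʳ-mod c a≈b = +-cong-mod a≈b (≈-refl {c})

  *-congˡ-mod : ∀ c {a b} → a ≈ b [mod n ] → (c *ℤ a) ≈ (c *ℤ b) [mod n ]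
  *-congˡ-mod c {a} {b} (≈-mod n∣a-b) = by (Signed.∣n⇒∣m*n c n∣a-b) (distrib c a b)
    where
    distrib : ∀ c a b → c *ℤ (a - b) ≡ c *ℤ a - c *ℤ b
    distrib = solve-∀

  *-congʳ-mod : ∀ c {a b} → a ≈ b [mod n ] → (a *ℤ c) ≈ (b *ℤ c) [mod n ]
  *-congʳ-mod c {a} {b} a≈b =
    subst₂ (λ x y → x ≈ y [mod n ]) (ℤ.*-comm c a) (ℤ.*-comm c b) (*-congˡ-mod c a≈b)

  neg-cong-mod : ∀ {a b} → a ≈ b [mod n ] → (- a) ≈ (- b) [mod n ]
  neg-cong-mod {a} {b} (≈-mod n∣a-b) = by (Signed.∣m⇒∣-m n∣a-b) (negate a b)
    where
    negate : ∀ a b → - (a - b) ≡ - a - - b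
    negate = solve-∀

  +-multiple-mod : ∀ a q → (a +ℤ q *ℤ + n) ≈ a [mod n ]
  +-multiple-mod a q = by (Signed.∣n⇒∣m*n q (Signed.∣-refl {+ n})) (cancel a q (+ n))
    where
    cancel : ∀ a q n → q *ℤ n ≡ (a +ℤ q *ℤ n) - a
    cancel = solve-∀

  ≈0⇒∣∣∣ : ∀ {a} → a ≈ 0ℤ [mod n ] → n ∣ ℤ.∣ a ∣
  ≈0⇒∣∣∣ {a} a≈0 = subst (n ∣_) (cong ℤ.∣_∣ (ℤ.+-identityʳ a)) (≈⇒≡-mod a≈0)

  ∣∣∣⇒≈0 : ∀ {a} → n ∣ ℤ.∣ a ∣ → a ≈ 0ℤ [mod n ]
  ∣∣∣⇒≈0 {a} n∣∣a∣ = ≡-mod⇒≈ (subst (n ∣_) (cong ℤ.∣_∣ (sym (ℤ.+-identityʳ a))) n∣∣a∣)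

  n≈0-mod : (+ n) ≈ 0ℤ [mod n ]
  n≈0-mod = by (Signed.∣-refl {+ n}) (sym (ℤ.+-identityʳ (+ n)))

  a-b≈0⇒a≈b : ∀ {a b} → (a - b) ≈ 0ℤ [mod n ] → a ≈ b [mod n ]
  a-b≈0⇒a≈b {a} {b} (≈-mod n∣a-b-0) = by n∣a-b-0 (ℤ.+-identityʳ (a - b))

≈-mod-setoid : ℕ → Setoid 0ℓ 0ℓ
≈-mod-setoid n = record
  { Carrier       = ℤ
  ; _≈_           = λ a b → a ≈ b [mod n ]
  ; isEquivalence = record { refl = ≈-refl ; sym = ≈-sym ; trans = ≈-trans }
  }

module ≈-mod-Reasoning (n : ℕ) = SetoidReasoning (≈-mod-setoid n)

≈-mod⇒∣∸ : ∀ {k m n} → n ≤ m → (+ m) ≈ (+ n) [mod k ] → k ∣ m ∸ n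
≈-mod⇒∣∸ {k} {m} {n} n≤m m≈n = subst (k ∣_) ∣[+m]-[+n]∣≡m∸n (≈⇒≡-mod m≈n)
  where
  open ≡-Reasoning
  ∣[+m]-[+n]∣≡m∸n : ℤ.∣ + m - + n ∣ ≡ m ∸ n
  ∣[+m]-[+n]∣≡m∸n = begin
    ℤ.∣ + m - + n ∣  ≡⟨ cong ℤ.∣_∣ (ℤ.[+m]-[+n]≡m⊖n m n) ⟩
    ℤ.∣ m ℤ.⊖ n ∣    ≡⟨ ℤ.∣m⊖n∣≡∣n⊖m∣ m n ⟩
    ℤ.∣ n ℤ.⊖ m ∣    ≡⟨ ℤ.∣⊖∣-≤ n≤m ⟩
    m ∸ n            ∎

∣∧<⇒≡0 : ∀ {k d} → k ∣ d → d < k → d ≡ 0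
∣∧<⇒≡0 {d = ℕ.zero}  _   _   = refl
∣∧<⇒≡0 {d = ℕ.suc _} k∣d d<k = contradiction (∣⇒≤ k∣d) (<⇒≱ d<k)

≈-mod⇒≤ : ∀ {k m n} → n ≤ m → m < k → (+ m) ≈ (+ n) [mod k ] → m ≤ n
≈-mod⇒≤ {k} {m} {n} n≤m m<k m≈n =
  m∸n≡0⇒m≤n (∣∧<⇒≡0 (≈-mod⇒∣∸ n≤m m≈n) (≤-<-trans (m∸n≤m m n) m<k))

≈-mod⇒≡ : ∀ {k m n} → m < k → n < k → (+ m) ≈ (+ n) [mod k ] → m ≡ n
≈-mod⇒≡ {k} {m} {n} m<k n<k m≈n with ≤-total n m
... | inj₁ n≤m = ≤-antisym (≈-mod⇒≤ n≤m m<k m≈n) n≤m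
... | inj₂ m≤n = sym (≤-antisym (≈-mod⇒≤ m≤n n<k (≈-sym m≈n)) m≤n)

m<n⇒m≤n∸1 : ∀ {m n} → m < n → m ≤ n ∸ 1
m<n⇒m≤n∸1 (s≤s m≤n) = m≤n

inverse-mod : ∀ {a n} → Coprime a n → ∃[ w ] (+ a *ℤ w) ≈ 1ℤ [mod n ]
inverse-mod {a} {n} coprime with Coprimality.coprime-Bézout coprime
... | Bézout.+- x y 1+yn≡xa = + x , (begin
  + a *ℤ + x         ≡⟨ ℤ.*-comm (+ a) (+ x) ⟩
  + x *ℤ + a         ≡⟨ ℤ.pos-* x a ⟨
  + (x * a)          ≡⟨ cong +_ 1+yn≡xa ⟨
  + (1 + y * n)      ≡⟨ cong (1ℤ +ℤ_) (ℤ.pos-* y n) ⟩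
  1ℤ +ℤ + y *ℤ + n   ≈⟨ +-multiple-mod 1ℤ (+ y) ⟩
  1ℤ                 ∎)
  where open ≈-mod-Reasoning n
... | Bézout.-+ x y 1+xa≡yn = - + x , (begin
  + a *ℤ - + x                         ≈⟨ +-multiple-mod _ (+ y) ⟨
  + a *ℤ - + x +ℤ + y *ℤ + n           ≡⟨ cong (λ z → + a *ℤ - + x +ℤ z) yn≡1+xa ⟩
  + a *ℤ - + x +ℤ (1ℤ +ℤ + x *ℤ + a)  ≡⟨ cancel (+ a) (+ x) ⟩
  1ℤ                                   ∎)
  where
  open ≈-mod-Reasoning n
  yn≡1+xa : + y *ℤ + n ≡ 1ℤ +ℤ + x *ℤ + a
  yn≡1+xa = trans (sym (ℤ.pos-* y n))
                  (trans (cong +_ (sym 1+xa≡yn)) (cong (1ℤ +ℤ_) (ℤ.pos-* x a)))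
  cancel : ∀ a x → a *ℤ - x +ℤ (1ℤ +ℤ x *ℤ a) ≡ 1ℤ
  cancel = solve-∀

%ℕ-≈-mod : ∀ {n} .{{_ : NonZero n}} a → (+ (a %ℕ n)) ≈ a [mod n ]
%ℕ-≈-mod {n} a = begin
  + (a %ℕ n)                      ≈⟨ +-multiple-mod _ (a /ℕ n) ⟨
  + (a %ℕ n) +ℤ (a /ℕ n) *ℤ + n   ≡⟨ a≡a%ℕn+[a/ℕn]*n a n ⟨
  a                               ∎
  where open ≈-mod-Reasoning n

linear-congruence-solution : ∀ {a n} .{{_ : NonZero n}} → Coprime a n → ∀ t →
                             ∃[ u ] u < n × (+ a *ℤ + u) ≈ t [mod n ]
linear-congruence-solution {a} {n} coprime t with inverse-mod coprime
... | w , aw≈1 = (w *ℤ t) %ℕ n , n%ℕd<d (w *ℤ t) n , (begin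
  + a *ℤ + ((w *ℤ t) %ℕ n)   ≈⟨ *-congˡ-mod (+ a) (%ℕ-≈-mod (w *ℤ t)) ⟩
  + a *ℤ (w *ℤ t)            ≡⟨ ℤ.*-assoc (+ a) w t ⟨
  (+ a *ℤ w) *ℤ t            ≈⟨ *-congʳ-mod t aw≈1 ⟩
  1ℤ *ℤ t                    ≡⟨ ℤ.*-identityˡ t ⟩
  t                          ∎)
  where open ≈-mod-Reasoning n

positive-solution : ∀ {a n u t} → ¬ (t ≈ 0ℤ [mod n ]) → (+ a *ℤ + u) ≈ t [mod n ] → 1 ≤ u
positive-solution {a} {u = ℕ.zero}  t≉0 a0≈t =
  contradiction (≈-trans (≈-sym a0≈t) (≈-reflexive (ℤ.*-zeroʳ (+ a)))) t≉0
positive-solution {u = ℕ.suc _} _   _    = s≤s z≤n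

positive-residue-solution : ∀ {a n t} .{{_ : NonZero n}} → Coprime a n → ¬ (t ≈ 0ℤ [mod n ]) →
                            ∃[ u ] 1 ≤ u × u ≤ n ∸ 1 × (+ a *ℤ + u) ≈ t [mod n ]
positive-residue-solution {a} {t = t} coprime t≉0 =
  let u , u<n , au≈t = linear-congruence-solution coprime t
  in  u , positive-solution {a} {u = u} t≉0 au≈t , m<n⇒m≤n∸1 u<n , au≈t

prime>1 : ∀ {p} → Prime p → 1 < p
prime>1 {p} p-prime = nonTrivial⇒n>1 p {{prime⇒nonTrivial p-prime}}

prime⇒∤ : ∀ {p d} → Prime p → 1 < d → d < p → d ∤ p
prime⇒∤ p-prime 1<d d<p d∣p = Prime.notComposite p-prime (composite d<p d∣p)
  where instance _ = n>1⇒nonTrivial 1<d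

coprime-below-prime : ∀ {p a} → Prime p → 1 ≤ a → a < p → Coprime a p
coprime-below-prime p-prime 1≤a a<p =
  Coprimality.sym (Coprimality.prime⇒coprime p-prime {{>-nonZero 1≤a}} a<p)

prime-*-cancelˡ-≈0 : ∀ {p c a} → Prime p → ¬ (c ≈ 0ℤ [mod p ]) →
                     (c *ℤ a) ≈ 0ℤ [mod p ] → a ≈ 0ℤ [mod p ]
prime-*-cancelˡ-≈0 {p} {c} {a} p-prime c≉0 ca≈0
  with euclidsLemma ℤ.∣ c ∣ ℤ.∣ a ∣ p-prime (subst (p ∣_) (ℤ.abs-* c a) (≈0⇒∣∣∣ ca≈0))
... | inj₁ p∣∣c∣ = contradiction (∣∣∣⇒≈0 p∣∣c∣) c≉0
... | inj₂ p∣∣a∣ = ∣∣∣⇒≈0 p∣∣a∣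

1≉0 : ∀ {n} → 1 < n → ¬ (1ℤ ≈ 0ℤ [mod n ])
1≉0 1<n 1≈0 = <⇒≱ 1<n (∣⇒≤ (≈0⇒∣∣∣ 1≈0))

m*m<n⇒m<n : ∀ {m n} → 1 ≤ m → m * m < n → m < n
m*m<n⇒m<n {m} 1≤m m*m<n = ≤-<-trans (m≤m*n m m {{>-nonZero 1≤m}}) m*m<n

m≤n∸2⇒m+1<n : ∀ {m n} → 2 ≤ n → m ≤ n ∸ 2 → m + 1 < n
m≤n∸2⇒m+1<n {m} {ℕ.suc (ℕ.suc n)} (s≤s (s≤s z≤n)) m≤n =
  s≤s (subst (m + 1 ≤_) (+-comm n 1) (+-monoˡ-≤ 1 m≤n))

1<m⊔n : ∀ {m n} → 1 ≤ m → 1 ≤ n → m ≢ n → 1 < m ⊔ n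
1<m⊔n {m} {n} 1≤m 1≤n m≢n with <-cmp m n
... | tri< m<n _   _   = <-≤-trans (≤-<-trans 1≤m m<n) (m≤n⊔m m n)
... | tri≈ _   m≡n _   = contradiction m≡n m≢n
... | tri> _   _   n<m = <-≤-trans (≤-<-trans 1≤n n<m) (m≤m⊔n m n)

xmax-exists : ∀ {p i} → Prime p → 1 ≤ i → i < p → ∃[ xm ] IsXMax p i xm
xmax-exists {p} {i} p-prime 1≤i i<p =
  let xm , 1≤xm , xm≤p∸1 , ixm≈1 = positive-residue-solution {i} {p} {1ℤ}
                                     {{prime⇒nonZero p-prime}}
                                     (coprime-below-prime p-prime 1≤i i<p) (1≉0 (prime>1 p-prime))
  in  xm , 1≤xm , xm≤p∸1 , ≈⇒≡-mod ixm≈1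

ymax-exists : ∀ {p i} → Prime p → i + 1 < p → ∃[ ym ] IsYMax p i ym
ymax-exists {p} {i} p-prime i+1<p =
  let ym , 1≤ym , ym≤p∸1 , [i+1]ym≈-1 = positive-residue-solution {i + 1} {p} { - 1ℤ}
                                          {{prime⇒nonZero p-prime}}
                                          (coprime-below-prime p-prime (m≤n+m 1 i) i+1<p)
                                          (λ -1≈0 → 1≉0 (prime>1 p-prime) (neg-cong-mod -1≈0))
  in  ym , 1≤ym , ym≤p∸1 , ≈⇒≡-mod (-[i+1]*ym≈1 ym [i+1]ym≈-1)
  where
  open ≈-mod-Reasoning p
  -[i+1]*ym≈1 : ∀ ym → (+ (i + 1) *ℤ + ym) ≈ - 1ℤ [mod p ] →
                (- (+ i +ℤ 1ℤ) *ℤ + ym) ≈ 1ℤ [mod p ]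
  -[i+1]*ym≈1 ym [i+1]ym≈-1 = begin
    - (+ i +ℤ 1ℤ) *ℤ + ym      ≡⟨ ℤ.neg-distribˡ-* (+ (i + 1)) (+ ym) ⟨
    - (+ (i + 1) *ℤ + ym)      ≈⟨ neg-cong-mod [i+1]ym≈-1 ⟩
    1ℤ                         ∎

p<M*[x+y] : ∀ {p M s r x y} → Prime p → 1 < M → M < p → s ≤ M → r ≤ M →
            0 < s * x + r * y → p ∣ s * x + r * y → p < M * (x + y)
p<M*[x+y] {p} {M} {s} {r} {x} {y} p-prime 1<M M<p s≤M r≤M 0<sx+ry p∣sx+ry =
  ≤∧≢⇒< p≤M[x+y] p≢M[x+y]
  where
  p≤M[x+y] : p ≤ M * (x + y)
  p≤M[x+y] = begin
    p              ≤⟨ ∣⇒≤ {{>-nonZero 0<sx+ry}} p∣sx+ry ⟩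
    s * x + r * y  ≤⟨ +-mono-≤ (*-monoˡ-≤ x s≤M) (*-monoˡ-≤ y r≤M) ⟩
    M * x + M * y  ≡⟨ *-distribˡ-+ M x y ⟨
    M * (x + y)    ∎
    where open ≤-Reasoning
  p≢M[x+y] : p ≢ M * (x + y)
  p≢M[x+y] p≡M[x+y] =
    prime⇒∤ p-prime 1<M M<p (divides (x + y) (trans p≡M[x+y] (*-comm M (x + y))))

module ResidueRelations
  {p i r s : ℕ} (i[r-s]≈s : (+ i *ℤ (+ r - + s)) ≈ (+ s) [mod p ])
  where

  open ≈-mod-Reasoning p

  s*xmax≈r-s : ∀ {xm} → (+ i *ℤ + xm) ≈ 1ℤ [mod p ] → (+ s *ℤ + xm) ≈ (+ r - + s) [mod p ]
  s*xmax≈r-s {xm} ixm≈1 = begin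
    + s *ℤ + xm                    ≈⟨ *-congʳ-mod (+ xm) i[r-s]≈s ⟨
    + i *ℤ (+ r - + s) *ℤ + xm     ≡⟨ regroup (+ i) (+ r - + s) (+ xm) ⟩
    (+ r - + s) *ℤ (+ i *ℤ + xm)   ≈⟨ *-congˡ-mod (+ r - + s) ixm≈1 ⟩
    (+ r - + s) *ℤ 1ℤ              ≡⟨ ℤ.*-identityʳ (+ r - + s) ⟩
    + r - + s                      ∎
    where
    regroup : ∀ a b c → a *ℤ b *ℤ c ≡ b *ℤ (a *ℤ c)
    regroup = solve-∀

  r≈[i+1][r-s] : (+ r) ≈ ((+ i +ℤ 1ℤ) *ℤ (+ r - + s)) [mod p ]
  r≈[i+1][r-s] = begin
    + r                                ≡⟨ split (+ r) (+ s) ⟩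
    (+ r - + s) +ℤ + s                 ≈⟨ +-congˡ-mod (+ r - + s) i[r-s]≈s ⟨
    (+ r - + s) +ℤ + i *ℤ (+ r - + s)  ≡⟨ collect (+ i) (+ r - + s) ⟩
    (+ i +ℤ 1ℤ) *ℤ (+ r - + s)         ∎
    where
    split : ∀ r s → r ≡ (r - s) +ℤ s
    split = solve-∀
    collect : ∀ i d → d +ℤ i *ℤ d ≡ (i +ℤ 1ℤ) *ℤ d
    collect = solve-∀

  r*ymax≈s-r : ∀ {ym} → (- (+ i +ℤ 1ℤ) *ℤ + ym) ≈ 1ℤ [mod p ] →
               (+ r *ℤ + ym) ≈ (+ s - + r) [mod p ]
  r*ymax≈s-r {ym} -[i+1]ym≈1 = begin
    + r *ℤ + ym                               ≈⟨ *-congʳ-mod (+ ym) r≈[i+1][r-s] ⟩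
    (+ i +ℤ 1ℤ) *ℤ (+ r - + s) *ℤ + ym        ≡⟨ regroup (+ i +ℤ 1ℤ) (+ r) (+ s) (+ ym) ⟩
    (+ s - + r) *ℤ (- (+ i +ℤ 1ℤ) *ℤ + ym)    ≈⟨ *-congˡ-mod (+ s - + r) -[i+1]ym≈1 ⟩
    (+ s - + r) *ℤ 1ℤ                         ≡⟨ ℤ.*-identityʳ (+ s - + r) ⟩
    + s - + r                                 ∎
    where
    regroup : ∀ j r s y → j *ℤ (r - s) *ℤ y ≡ (s - r) *ℤ (- j *ℤ y)
    regroup = solve-∀

  [r-s]*[ix+[i+1]y]≈sx+ry : ∀ x y →
    ((+ r - + s) *ℤ (+ i *ℤ + x +ℤ (+ i +ℤ 1ℤ) *ℤ + y)) ≈ (+ (s * x + r * y)) [mod p ]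
  [r-s]*[ix+[i+1]y]≈sx+ry x y = begin
    (+ r - + s) *ℤ (+ i *ℤ + x +ℤ (+ i +ℤ 1ℤ) *ℤ + y)
      ≡⟨ expand (+ i) (+ r) (+ s) (+ x) (+ y) ⟩
    + i *ℤ (+ r - + s) *ℤ (+ x +ℤ + y) +ℤ (+ r - + s) *ℤ + y
      ≈⟨ +-congʳ-mod ((+ r - + s) *ℤ + y) (*-congʳ-mod (+ x +ℤ + y) i[r-s]≈s) ⟩
    + s *ℤ (+ x +ℤ + y) +ℤ (+ r - + s) *ℤ + y
      ≡⟨ collect (+ r) (+ s) (+ x) (+ y) ⟩
    + s *ℤ + x +ℤ + r *ℤ + y
      ≡⟨ cong₂ _+ℤ_ (ℤ.pos-* s x) (ℤ.pos-* r y) ⟨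
    + (s * x) +ℤ + (r * y)
      ≡⟨ ℤ.pos-+ (s * x) (r * y) ⟨
    + (s * x + r * y)
      ∎
    where
    expand : ∀ i r s x y → (r - s) *ℤ (i *ℤ x +ℤ (i +ℤ 1ℤ) *ℤ y) ≡
                           i *ℤ (r - s) *ℤ (x +ℤ y) +ℤ (r - s) *ℤ y
    expand = solve-∀
    collect : ∀ r s x y → s *ℤ (x +ℤ y) +ℤ (r - s) *ℤ y ≡ s *ℤ x +ℤ r *ℤ y
    collect = solve-∀

  admissible⇒sx+ry≈0 : ∀ {x y} → (+ i *ℤ + x +ℤ (+ i +ℤ 1ℤ) *ℤ + y) ≈ 0ℤ [mod p ] →
                       (+ (s * x + r * y)) ≈ 0ℤ [mod p ]
  admissible⇒sx+ry≈0 {x} {y} ix+[i+1]y≈0 = begin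
    + (s * x + r * y)                                  ≈⟨ [r-s]*[ix+[i+1]y]≈sx+ry x y ⟨
    (+ r - + s) *ℤ (+ i *ℤ + x +ℤ (+ i +ℤ 1ℤ) *ℤ + y)  ≈⟨ *-congˡ-mod (+ r - + s) ix+[i+1]y≈0 ⟩
    (+ r - + s) *ℤ 0ℤ                                  ≡⟨ ℤ.*-zeroʳ (+ r - + s) ⟩
    0ℤ                                                 ∎

  sx+ry≈0⇒admissible : ∀ {x y} → Prime p → ¬ ((+ r - + s) ≈ 0ℤ [mod p ]) →
                       (+ (s * x + r * y)) ≈ 0ℤ [mod p ] →
                       (+ i *ℤ + x +ℤ (+ i +ℤ 1ℤ) *ℤ + y) ≈ 0ℤ [mod p ]
  sx+ry≈0⇒admissible {x} {y} p-prime r-s≉0 sx+ry≈0 =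
    prime-*-cancelˡ-≈0 p-prime r-s≉0 (≈-trans ([r-s]*[ix+[i+1]y]≈sx+ry x y) sx+ry≈0)

prime≡B*u+A*q : ∀ {p A B} → Prime p → Coprime B A → 1 < A → A < p → B * A < p →
                ∃[ u ] ∃[ q ] 1 ≤ u × u < A × 1 ≤ q × B * u + A * q ≡ p
prime≡B*u+A*q {p} {A} {B} p-prime coprime 1<A A<p B*A<p =
  let u , u<A , Bu≈p = linear-congruence-solution {B} {A} {{>-nonZero (<-trans z<s 1<A)}}
                         coprime (+ p)
  in  u , representation u<A Bu≈p
  where
  representation : ∀ {u} → u < A → (+ B *ℤ + u) ≈ (+ p) [mod A ] →
                   ∃[ q ] 1 ≤ u × u < A × 1 ≤ q × B * u + A * q ≡ p
  representation {u} u<A Bu≈p = q , 1≤u , u<A , 1≤q , Bu+Aq≡p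
    where
    1≤u : 1 ≤ u
    1≤u = positive-solution {B} {u = u}
            (λ p≈0 → prime⇒∤ p-prime 1<A A<p (≈-mod⇒∣∸ z≤n p≈0)) Bu≈p
    Bu<p : B * u < p
    Bu<p = ≤-<-trans (*-monoʳ-≤ B (<⇒≤ u<A)) B*A<p
    A∣p∸Bu : A ∣ p ∸ B * u
    A∣p∸Bu = ≈-mod⇒∣∸ (<⇒≤ Bu<p)
               (≈-sym (subst (λ z → z ≈ + p [mod A ]) (sym (ℤ.pos-* B u)) Bu≈p))
    q : ℕ
    q = quotient A∣p∸Bu
    p∸Bu≡qA : p ∸ B * u ≡ q * A
    p∸Bu≡qA = m∣n⇒n≡quotient*m A∣p∸Bu
    1≤q : 1 ≤ q
    1≤q = n≢0⇒n>0 λ q≡0 → <⇒≱ Bu<p (m∸n≡0⇒m≤n (trans p∸Bu≡qA (cong (_* A) q≡0)))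
    Bu+Aq≡p : B * u + A * q ≡ p
    Bu+Aq≡p = trans (cong (B * u ℕ.+_) (trans (*-comm A q) (sym p∸Bu≡qA)))
                    (m+[n∸m]≡n (<⇒≤ Bu<p))

A*[u+q]<p+A*[A∸1] : ∀ {p A B u q} → u < A → 0 < B * u → B * u + A * q ≡ p →
                    A * (u + q) < p + A * (A ∸ 1)
A*[u+q]<p+A*[A∸1] {p} {A} {B} {u} {q} u<A 0<Bu Bu+Aq≡p = begin-strict
  A * (u + q)              ≡⟨ *-distribˡ-+ A u q ⟩
  A * u + A * q            <⟨ +-monoʳ-< (A * u) (m<n+m (A * q) 0<Bu) ⟩
  A * u + (B * u + A * q)  ≡⟨ cong (A * u ℕ.+_) Bu+Aq≡p ⟩
  A * u + p                ≤⟨ +-monoˡ-≤ p (*-monoʳ-≤ A (m<n⇒m≤n∸1 u<A)) ⟩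
  A * (A ∸ 1) + p          ≡⟨ +-comm (A * (A ∸ 1)) p ⟩
  p + A * (A ∸ 1)          ∎
  where open ≤-Reasoning

module ShortRepresentation
  {p A B X Y : ℕ} (p-prime : Prime p) (1≤B : 1 ≤ B) (B<A : B < A) (A*A<p : A * A < p)
  (coprime : Coprime B A)
  (BX≈A-B : (+ B *ℤ + X) ≈ (+ A - + B) [mod p ])
  (AY≈B-A : (+ A *ℤ + Y) ≈ (+ B - + A) [mod p ])
  where

  A<p : A < p
  A<p = m*m<n⇒m<n (≤-trans 1≤B (<⇒≤ B<A)) A*A<p

  u≤X : ∀ {u} → u < A → B * u < p → u ≤ X
  u≤X {u} u<A Bu<p = ≮⇒≥ X≮u
    where
    B[1+X]≈A : (+ (B * ℕ.suc X)) ≈ (+ A) [mod p ]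
    B[1+X]≈A = begin
      + (B * ℕ.suc X)           ≡⟨ ℤ.pos-* B (ℕ.suc X) ⟩
      + B *ℤ (1ℤ +ℤ + X)        ≡⟨ distrib (+ B) (+ X) ⟩
      + B *ℤ + X +ℤ + B         ≈⟨ +-congʳ-mod (+ B) BX≈A-B ⟩
      (+ A - + B) +ℤ + B        ≡⟨ cancel (+ A) (+ B) ⟩
      + A                       ∎
      where
      open ≈-mod-Reasoning p
      distrib : ∀ b x → b *ℤ (1ℤ +ℤ x) ≡ b *ℤ x +ℤ b
      distrib = solve-∀
      cancel : ∀ a b → (a - b) +ℤ b ≡ a
      cancel = solve-∀
    X≮u : ¬ X < u
    X≮u X<u = <⇒≱ X<u (s≤s⁻¹ (subst (u <_) A≡1+X u<A))
      where
      B[1+X]≡A : B * ℕ.suc X ≡ A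
      B[1+X]≡A = ≈-mod⇒≡ (≤-<-trans (*-monoʳ-≤ B X<u) Bu<p) A<p B[1+X]≈A
      B≡1 : B ≡ 1
      B≡1 = coprime (∣-refl , divides (ℕ.suc X) (trans (sym B[1+X]≡A) (*-comm B (ℕ.suc X))))
      A≡1+X : A ≡ ℕ.suc X
      A≡1+X = trans (sym B[1+X]≡A) (trans (cong (_* ℕ.suc X) B≡1) (*-identityˡ (ℕ.suc X)))

  q≤Y : ∀ {q} → A * q < p → q ≤ Y
  q≤Y {q} Aq<p = ≮⇒≥ Y≮q
    where
    AY+[A∸B]≈0 : (+ (A * Y + (A ∸ B))) ≈ 0ℤ [mod p ]
    AY+[A∸B]≈0 = begin
      + (A * Y + (A ∸ B))          ≡⟨ ℤ.pos-+ (A * Y) (A ∸ B) ⟩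
      + (A * Y) +ℤ + (A ∸ B)       ≡⟨ cong₂ _+ℤ_ (ℤ.pos-* A Y) (sym [+A]-[+B]≡+[A∸B]) ⟩
      + A *ℤ + Y +ℤ (+ A - + B)    ≈⟨ +-congʳ-mod (+ A - + B) AY≈B-A ⟩
      (+ B - + A) +ℤ (+ A - + B)   ≡⟨ cancel (+ A) (+ B) ⟩
      0ℤ                           ∎
      where
      open ≈-mod-Reasoning p
      [+A]-[+B]≡+[A∸B] : + A - + B ≡ + (A ∸ B)
      [+A]-[+B]≡+[A∸B] = trans (ℤ.[+m]-[+n]≡m⊖n A B) (ℤ.⊖-≥ (<⇒≤ B<A))
      cancel : ∀ a b → (b - a) +ℤ (a - b) ≡ 0ℤ
      cancel = solve-∀
    Y≮q : ¬ Y < q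
    Y≮q Y<q = <⇒≢ 0<AY+[A∸B] (sym (≈-mod⇒≡ AY+[A∸B]<p (<-trans z<s 1<p) AY+[A∸B]≈0))
      where
      1<p : 1 < p
      1<p = prime>1 p-prime
      0<AY+[A∸B] : 0 < A * Y + (A ∸ B)
      0<AY+[A∸B] = <-≤-trans (m<n⇒0<n∸m B<A) (m≤n+m (A ∸ B) (A * Y))
      AY+[A∸B]<p : A * Y + (A ∸ B) < p
      AY+[A∸B]<p = begin-strict
        A * Y + (A ∸ B)   ≤⟨ +-monoʳ-≤ (A * Y) (m∸n≤m A B) ⟩
        A * Y + A         ≡⟨ +-comm (A * Y) A ⟩
        A + A * Y         ≡⟨ *-suc A Y ⟨
        A * ℕ.suc Y       ≤⟨ *-monoʳ-≤ A Y<q ⟩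
        A * q             <⟨ Aq<p ⟩
        p                 ∎
        where open ≤-Reasoning

  short-pair : ∃[ u ] ∃[ q ] 1 ≤ u × 1 ≤ q × u ≤ X × q ≤ Y ×
               B * u + A * q ≡ p × A * (u + q) < p + A * (A ∸ 1)
  short-pair =
    bound (prime≡B*u+A*q {p} {A} {B} p-prime coprime (≤-<-trans 1≤B B<A) A<p B*A<p)
    where
    B*A<p : B * A < p
    B*A<p = ≤-<-trans (*-monoˡ-≤ A (<⇒≤ B<A)) A*A<p
    bound : ∃[ u ] ∃[ q ] 1 ≤ u × u < A × 1 ≤ q × B * u + A * q ≡ p →
            ∃[ u ] ∃[ q ] 1 ≤ u × 1 ≤ q × u ≤ X × q ≤ Y ×
            B * u + A * q ≡ p × A * (u + q) < p + A * (A ∸ 1)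
    bound (u , q , 1≤u , u<A , 1≤q , Bu+Aq≡p) =
      u , q , 1≤u , 1≤q , u≤X u<A Bu<p , q≤Y Aq<p , Bu+Aq≡p ,
      A*[u+q]<p+A*[A∸1] {B = B} u<A 0<Bu Bu+Aq≡p
      where
      0<Bu : 0 < B * u
      0<Bu = *-mono-≤ 1≤B 1≤u
      Bu<p : B * u < p
      Bu<p = subst (B * u <_) Bu+Aq≡p (m<m+n (B * u) (*-mono-≤ (≤-trans 1≤B (<⇒≤ B<A)) 1≤q))
      Aq<p : A * q < p
      Aq<p = subst (A * q <_) (trans (+-comm (A * q) (B * u)) Bu+Aq≡p) (m<m+n (A * q) 0<Bu)

module Bounds
  {p i r s : ℕ} (p-prime : Prime p) (1≤r : 1 ≤ r) (1≤s : 1 ≤ s) (coprime : Coprime r s)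
  (r*r<p : r * r < p) (s*s<p : s * s < p) (r≢s : r ≢ s)
  (i[r-s]≈s : (+ i *ℤ (+ r - + s)) ≈ (+ s) [mod p ])
  where

  open ResidueRelations {p} {i} {r} {s} i[r-s]≈s

  r<p : r < p
  r<p = m*m<n⇒m<n 1≤r r*r<p

  s<p : s < p
  s<p = m*m<n⇒m<n 1≤s s*s<p

  r-s≉0 : ¬ ((+ r - + s) ≈ 0ℤ [mod p ])
  r-s≉0 r-s≈0 = r≢s (≈-mod⇒≡ r<p s<p (a-b≈0⇒a≈b r-s≈0))

  admissible : ∀ {xm ym x y} → 1 ≤ x → 1 ≤ y → x ≤ xm → y ≤ ym → s * x + r * y ≡ p →
               Admissible p i xm ym x y
  admissible {x = x} {y} 1≤x 1≤y x≤xm y≤ym sx+ry≡p =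
    1≤x , 1≤y , x≤xm , y≤ym ,
    ≈⇒≡-mod (sx+ry≈0⇒admissible {x} {y} p-prime r-s≉0
               (≈-trans (≈-reflexive (cong +_ sx+ry≡p)) n≈0-mod))

  lower-bound : ∀ {xm ym x y} → Admissible p i xm ym x y → p < (r ⊔ s) * (x + y)
  lower-bound {x = x} {y} (1≤x , _ , _ , _ , ix+[i+1]y≡0) =
    p<M*[x+y] {x = x} {y} p-prime (1<m⊔n 1≤r 1≤s r≢s) (⊔-pres-<m r<p s<p)
      (m≤n⊔m r s) (m≤m⊔n r s) (≤-trans (*-mono-≤ 1≤s 1≤x) (m≤m+n (s * x) (r * y)))
      (≈-mod⇒∣∸ z≤n (admissible⇒sx+ry≈0 {x} {y} (≡-mod⇒≈ ix+[i+1]y≡0)))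

  short-admissible-pair : ∀ {xm ym} → IsXMax p i xm → IsYMax p i ym →
    ∃[ x ] ∃[ y ] Admissible p i xm ym x y × (r ⊔ s) * (x + y) < p + (r ⊔ s) * ((r ⊔ s) ∸ 1)
  short-admissible-pair {xm} {ym} (_ , _ , ixm≡1) (_ , _ , -[i+1]ym≡1) with <-cmp r s
  ... | tri< r<s _ _ =
    let u , q , 1≤u , 1≤q , u≤ym , q≤xm , ru+sq≡p , s[u+q]<p+s[s∸1] =
          ShortRepresentation.short-pair {p} {s} {r} {ym} {xm} p-prime 1≤r r<s s*s<p coprime
            (r*ymax≈s-r (≡-mod⇒≈ -[i+1]ym≡1)) (s*xmax≈r-s (≡-mod⇒≈ ixm≡1))
    in  q , u , admissible 1≤q 1≤u q≤xm u≤ym (trans (+-comm (s * q) (r * u)) ru+sq≡p) ,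
        subst (λ M → M * (q + u) < p + M * (M ∸ 1)) (sym (m≤n⇒m⊔n≡n (<⇒≤ r<s)))
          (subst (λ k → s * k < p + s * (s ∸ 1)) (+-comm u q) s[u+q]<p+s[s∸1])
  ... | tri≈ _ r≡s _ = contradiction r≡s r≢s
  ... | tri> _ _ s<r =
    let u , q , 1≤u , 1≤q , u≤xm , q≤ym , su+rq≡p , r[u+q]<p+r[r∸1] =
          ShortRepresentation.short-pair {p} {r} {s} {xm} {ym} p-prime 1≤s s<r r*r<p
            (Coprimality.sym coprime)
            (s*xmax≈r-s (≡-mod⇒≈ ixm≡1)) (r*ymax≈s-r (≡-mod⇒≈ -[i+1]ym≡1))
    in  u , q , admissible 1≤u 1≤q u≤xm q≤ym su+rq≡p ,
        subst (λ M → M * (u + q) < p + M * (M ∸ 1)) (sym (m≥n⇒m⊔n≡m (<⇒≤ s<r))) r[u+q]<p+r[r∸1]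

lemma2p7 : (p i r s : ℕ) → Prime p → 1 ≤ i → i ≤ p ∸ 2 →
    1 ≤ r → 1 ≤ s → Coprime r s → r * r < p → s * s < p → r ≢ s →
    ((+ i) *ℤ ((+ r) - (+ s))) ≡ (+ s) [mod p ] →
    (x y : ℕ) → IsMinPair p i x y →
    p < (r ⊔ s) * (x + y) × (r ⊔ s) * (x + y) < p + (r ⊔ s) * ((r ⊔ s) ∸ 1)
lemma2p7 p i r s p-prime 1≤i i≤p∸2 1≤r 1≤s coprime r*r<p s*s<p r≢s i[r-s]≡s x y isMinPair =
  let xm , xm-max = xmax-exists p-prime 1≤i (≤-<-trans (m≤m+n i 1) i+1<p)
      ym , ym-max = ymax-exists p-prime i+1<p
      admissible-xy , minimal = isMinPair xm-max ym-max
      x′ , y′ , admissible-x′y′ , M[x′+y′]<p+M[M∸1] = short-admissible-pair xm-max ym-max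
  in  lower-bound admissible-xy ,
      ≤-<-trans (*-monoʳ-≤ (r ⊔ s) (minimal x′ y′ admissible-x′y′)) M[x′+y′]<p+M[M∸1]
  where
  open Bounds {p} {i} {r} {s} p-prime 1≤r 1≤s coprime r*r<p s*s<p r≢s (≡-mod⇒≈ i[r-s]≡s)
  i+1<p : i + 1 < p
  i+1<p = m≤n∸2⇒m+1<n (prime>1 p-prime) i≤p∸2
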